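{- Let $\mathcal{T}$ be a weak $X$-tree, let $v$ be a labelled interior vertex of $\mathcal{T}$, let $\mathcal{D}(\mathcal{T},v)=\{\mathcal{T}_1,\dots,\mathcal{T}_k\}$, and let $\Pi$ be a partition system on $X$. Then $\Pi\in\mathbb{P}(\mathcal{T})$ if and only if there is a partition $\{\Pi_1,\dots,\Pi_k\}$ of $\Pi$ (i.e. $\Pi=\Pi_1\uplus\cdots\uplus\Pi_k$) such that $\Pi_i\in\mathbb{P}(\mathcal{T}_i)$ for all $i\in\{1,\dots,k\}$. Moreover, if $\Pi\in\mathbb{P}(\mathcal{T})$, then such a partition of $\Pi$ is unique.
   Context: $X$ is a finite set with $|X|\ge 2$. A partition of $X$ is a set of $t\ge 2$ pairwise disjoint non-empty subsets (parts) whose union is $X$; an $X$-split is a partition with two parts, written $A|(X-A)$. A partition system is a finite multiset of partitions of $X$; $\Sigma_\Pi=\biguplus_{\pi\in\Pi}\biguplus_{A\in\pi}\{A|(X-A)\}$ (multiset union $\uplus$). A weak $X$-tree $\mathcal{T}=(T;\phi)$ is a tree $T$ with $\phi:X\to V(T)$ such that every leaf lies in $\phi(X)$; vertices in $\phi(X)$ are labelled; interior vertices are non-leaves. For an edge $e$, $\sigma_e=A|(X-A)$ with $A=\phi^{ -1}(W)$, $W$ the vertex set of a component of $T-e$; $\Sigma(\mathcal{T})=\biguplus_e\{\sigma_e\}$; $\mathbb{P}(\mathcal{T})$ is the set of partition systems $\Pi$ with $\Sigma_\Pi=\Sigma(\mathcal{T})$. Decomposition: if $v$ is a labelled interior vertex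 of degree $k$, partition the edge set of $\mathcal{T}$ into $E_1,\dots,E_k$ where two edges are in the same class iff the path between them avoids $v$; let $e_i\in E_i$ be the edge incident with $v$ and $A_i|B_i=\sigma_{e_i}$ with $\phi^{ -1}(v)\subseteq B_i$. $\mathcal{T}_i$ is the subtree formed by the edges $E_i$ with map $\phi_i(x)=\phi(x)$ if $\phi(x)$ is a vertex of this subtree other than $v$, and $\phi_i(x)=v$ for $x\in B_i$ (so $v$ receives the label set $B_i$). $\mathcal{D}(\mathcal{T},v)=\{\mathcal{T}_1,\dots,\mathcal{T}_k\}$. -}

module Defs where

open import Data.Nat using (ℕ; zero; suc; _≤_)
open import Data.Bool using (Bool; true; false; not)
open import Data.Fin using (Fin; toℕ)
open import Data.Fin.Subset using (Subset; ∁; _∪_; _∩_; ⋃; Nonempty; Empty; ⊤)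
open import Data.List using (List; []; _∷_; _++_; length; lookup; take; drop; concat; concatMap; tabulate)
open import Data.List.Relation.Unary.All using (All)
open import Data.List.Relation.Unary.AllPairs using (AllPairs)
open import Data.Vec using (Vec; []; _∷_)
import Data.Vec as Vec
open import Data.Product using (_×_; _,_)
open import Data.Sum using (_⊎_; inj₁; inj₂)
open import Relation.Nullary using (¬_)
open import Relation.Binary using (Setoid; IsEquivalence)
open import Relation.Binary.PropositionalEquality using (_≡_; refl; sym; trans; cong; cong₂)
import Data.List.Relation.Binary.Permutation.Propositional as PermP
import Data.List.Relation.Binary.Permutation.Setoid as PermS

-- The ground set X is  Fin n  (a finite set with |X| = n).

-- X-splits.  A split A|(X-A) is represented by one of its sides A; two
-- representatives denote the same (unordered) split iff they are equal
-- or complementary.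

∁∁ : ∀ {n} (A : Subset n) → ∁ (∁ A) ≡ A
∁∁ []          = refl
∁∁ (true ∷ A)  = cong (true ∷_) (∁∁ A)
∁∁ (false ∷ A) = cong (false ∷_) (∁∁ A)

_≈ˢ_ : ∀ {n} → Subset n → Subset n → Set
A ≈ˢ C = (A ≡ C) ⊎ (A ≡ ∁ C)

private
  ≈ˢ-sym : ∀ {n} {A C : Subset n} → A ≈ˢ C → C ≈ˢ A
  ≈ˢ-sym (inj₁ e) = inj₁ (sym e)
  ≈ˢ-sym {C = C} (inj₂ e) = inj₂ (trans (sym (∁∁ C)) (cong ∁ (sym e)))

  ≈ˢ-trans : ∀ {n} {A C D : Subset n} → A ≈ˢ C → C ≈ˢ D → A ≈ˢ D
  ≈ˢ-trans (inj₁ e) q = Relation.Binary.PropositionalEquality.subst (λ Z → Z ≈ˢ _) (sym e) q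
  ≈ˢ-trans (inj₂ e) (inj₁ f) = inj₂ (trans e (cong ∁ f))
  ≈ˢ-trans {D = D} (inj₂ e) (inj₂ f) = inj₁ (trans e (trans (cong ∁ f) (∁∁ D)))

SplitSetoid : ℕ → Setoid _ _
SplitSetoid n = record
  { Carrier = Subset n
  ; _≈_ = _≈ˢ_
  ; isEquivalence = record { refl = inj₁ refl ; sym = ≈ˢ-sym ; trans = ≈ˢ-trans }
  }

_≈Σ_ : ∀ {n} → List (Subset n) → List (Subset n) → Set
_≈Σ_ {n} = PermS._↭_ (SplitSetoid n)

-- Partitions of X: a set of t ≥ 2 pairwise disjoint non-empty parts
-- whose union is X.  The parts are listed; two partitions are equal
-- iff their lists of parts are permutations of each other.

record Partition (n : ℕ) : Set where
  field
    parts    : List (Subset n)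
    atLeast2 : 2 ≤ length parts
    nonempty : All Nonempty parts
    disjoint : AllPairs (λ A B → Empty (A ∩ B)) parts
    covers   : ⋃ parts ≡ ⊤
open Partition public

PartitionSetoid : ℕ → Setoid _ _
PartitionSetoid n = record
  { Carrier = Partition n
  ; _≈_ = λ π ρ → parts π PermP.↭ parts ρ
  ; isEquivalence = record { refl = PermP.↭-refl ; sym = PermP.↭-sym ; trans = PermP.↭-trans }
  }

-- partition systems: finite multisets of partitions of X
PartitionSystem : ℕ → Set
PartitionSystem n = List (Partition n)

_≈Π_ : ∀ {n} → PartitionSystem n → PartitionSystem n → Set
_≈Π_ {n} = PermS._↭_ (PartitionSetoid n)

-- Σ_Π : each part A of each π ∈ Π contributes the split A|(X-A)
ΣΠ : ∀ {n} → PartitionSystem n → List (Subset n)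
ΣΠ Π = concatMap parts Π

-- A tree is stored rooted at an arbitrary vertex: node L cs is a vertex
-- with label set L = φ⁻¹(vertex) and neighbouring subtrees cs.  Edges are
-- the parent–child links.

data Tree (n : ℕ) : Set where
  node : Subset n → List (Tree n) → Tree n

mutual
  labels : ∀ {n} → Tree n → Subset n
  labels (node L cs) = L ∪ labelsF cs

  labelsF : ∀ {n} → List (Tree n) → Subset n
  labelsF []       = Data.Fin.Subset.⊥
  labelsF (c ∷ cs) = labels c ∪ labelsF cs

mutual
  occ : ∀ {n} → Fin n → Tree n → ℕ
  occ x (node L cs) = (if Vec.lookup L x then 1 else 0) Data.Nat.+ occF x cs
    where open import Data.Bool using (if_then_else_)

  occF : ∀ {n} → Fin n → List (Tree n) → ℕ
  occF x []       = 0
  occF x (c ∷ cs) = occ x c Data.Nat.+ occF x cs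

mutual
  -- Σ(T): for each edge (parent, child c), the split σ_e = A|(X-A) with
  -- A = φ⁻¹(vertices of the subtree at c)
  splits : ∀ {n} → Tree n → List (Subset n)
  splits (node L cs) = splitsF cs

  splitsF : ∀ {n} → List (Tree n) → List (Subset n)
  splitsF []       = []
  splitsF (c ∷ cs) = labels c ∷ splits c ++ splitsF cs

_∈ℙ_ : ∀ {n} → PartitionSystem n → Tree n → Set
Π ∈ℙ T = ΣΠ Π ≈Σ splits T

-- Vertices of a tree (positions) and the zipper view at a vertex.

data Pos {n : ℕ} : Tree n → Set where
  here  : ∀ {t} → Pos t
  there : ∀ {L cs} (i : Fin (length cs)) → Pos (lookup cs i) → Pos (node L cs)

data Ctx (n : ℕ) : Set where
  top  : Ctx n
  -- parent label, siblings to the left, parent's context, siblings to the right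
  down : Subset n → List (Tree n) → Ctx n → List (Tree n) → Ctx n

-- the component of (T - edge to parent), containing the parent,
-- re-rooted at the parent (empty list if the vertex is the root)
up : ∀ {n} → Ctx n → List (Tree n)
up top                = []
up (down L ls ctx rs) = node L (ls ++ rs ++ up ctx) ∷ []

focusAt : ∀ {n} (t : Tree n) → Pos t → Ctx n → Ctx n × Tree n
focusAt t here ctx = ctx , t
focusAt (node L cs) (there i p) ctx =
  focusAt (lookup cs i) p (down L (take (toℕ i) cs) ctx (drop (suc (toℕ i)) cs))

focus : ∀ {n} (t : Tree n) → Pos t → Ctx n × Tree n
focus t p = focusAt t p top

labelAt : ∀ {n} (t : Tree n) → Pos t → Subset n
labelAt t p with focus t p
... | _ , node L _ = L

-- the branches at v: for each edge e incident with v, the component of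
-- T - e not containing v, rooted at the other endpoint of e
branches : ∀ {n} (t : Tree n) → Pos t → List (Tree n)
branches t p with focus t p
... | ctx , node _ cs = cs ++ up ctx

degree : ∀ {n} (t : Tree n) → Pos t → ℕ
degree t p = length (branches t p)

IsLeaf : ∀ {n} (t : Tree n) → Pos t → Set
IsLeaf t p = degree t p ≡ 1

Interior : ∀ {n} (t : Tree n) → Pos t → Set
Interior t p = ¬ IsLeaf t p

Labelled : ∀ {n} (t : Tree n) → Pos t → Set
Labelled t p = Nonempty (labelAt t p)

-- weak X-tree: φ is a function X → V(T) (each x labels exactly one
-- vertex) and every leaf is labelled
WeakXTree : ∀ {n} → Tree n → Set
WeakXTree t = (∀ x → occ x t ≡ 1) × (∀ (p : Pos t) → IsLeaf t p → Labelled t p)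

-- Decomposition 𝒟(T,v) = {T_1,…,T_k}, k = deg v.  T_i consists of the
-- edge e_i and the branch beyond it; v receives label set B_i = X - A_i,
-- where A_i = φ⁻¹(branch).  T_i is rooted at v.

decomp : ∀ {n} (t : Tree n) (p : Pos t) → Fin (degree t p) → Tree n
decomp t p i = node (∁ (labels b)) (b ∷ [])
  where b = lookup (branches t p) i

-- a partition {Π_1,…,Π_k} of Π, indexed along 𝒟(T,v)
IsDecompOf : ∀ {n k} → (Fin k → PartitionSystem n) → PartitionSystem n → Set
IsDecompOf {k = k} Πs Π = Π ≈Π concat (tabulate Πs)

module Submission where

-- Write A₁ … A_k for the label sets of the branches of T at v.  They are
-- pairwise disjoint, avoid a label x₀ of v, and every split of T_i has a
-- side inside A_i; call such a split "below A_i".  The argument is: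
--   * Σ(T) is the multiset union of the Σ(T_i)  (re-rooting T at v);
--   * a proper split is below at most one A_i (its x₀-free side is a
--     non-empty subset of A_i);
--   * if every part of a partition π is below some A_j, then all parts of π
--     are below one common A_i (the complement of the part containing x₀
--     lies in A_i and contains every other part), and this i is unique.
-- Sorting the partitions of Π into classes by this index i gives the pieces
-- Π_i.  Both the existence and the uniqueness of the pieces then follow from
-- one fact about multisets: lists whose members lie in exactly one class
-- each are determined, class by class, by their union (filter by the class).

open import Defs
open import Data.Nat using (ℕ; _≤_)
open import Data.Fin using (Fin)
open import Data.Product using (Σ; _×_)
open import Function.Bundles using (_⇔_)

open import Level using (Level)
open import Data.Nat using (zero; suc; _+_; z≤n; s≤s)
open import Data.Nat.Properties
  using (+-assoc; +-identityʳ; m≤m+n; m≤n+m; ≤-trans; ≤-reflexive; +-mono-≤; +-monoʳ-≤; 1+n≰n; module ≤-Reasoning)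
open import Data.Bool using (Bool; true; false; not; _∨_; if_then_else_)
open import Data.Fin using (toℕ) renaming (zero to fzero; suc to fsuc)
open import Data.Fin.Properties using (suc-injective)
open import Data.Fin.Subset using (Subset; ∁; _∪_; _∩_; ⋃; _∈_; _∉_; _⊆_; Nonempty; Empty)
open import Data.Fin.Subset.Properties
  using (_∈?_; _⊆?_; ⊆-refl; p⊆p∪q; q⊆p∪q; x∈p∪q⁻; x∈p∩q⁺; x∈p∩q⁻;
         x∉p⇒x∈∁p; ∉⊥; ∈⊤)
open import Data.Vec using (Vec; []; _∷_)
import Data.Vec as Vec
open import Data.Vec.Properties
  using (lookup-zipWith; lookup-map; lookup-replicate; []=⇒lookup; tabulate∘lookup; tabulate-cong)
open import Data.List using (List; []; _∷_; _++_; [_]; length; take; drop; concat; concatMap; tabulate; filter)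
import Data.List as List
open import Data.List.Properties using (++-identityʳ; filter-all; filter-none; filter-accept; filter-reject; filter-++; concatMap-++)
import Data.List.Properties as ListProps
open import Data.List.Relation.Unary.All using (All; []; _∷_; all?)
import Data.List.Relation.Unary.All as All
open import Data.List.Relation.Unary.All.Properties using (concat⁺; concat⁻; map⁺; map⁻; tabulate⁺; tabulate⁻; ++⁺; all-filter)
open import Data.List.Relation.Unary.Any using (Any; here; there)
import Data.List.Relation.Unary.Any as Any
open import Data.List.Relation.Unary.AllPairs using (AllPairs; []; _∷_)
import Data.List.Relation.Binary.Permutation.Propositional as ↭
import Data.List.Relation.Binary.Permutation.Propositional.Properties as ↭
import Data.List.Relation.Binary.Permutation.Setoid as PermS
import Data.List.Relation.Binary.Permutation.Setoid.Properties as PermSP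
open import Data.Product using (∃; _,_; proj₁; proj₂; uncurry; swap)
open import Data.Sum using (_⊎_; inj₁; inj₂; [_,_]′)
open import Data.Empty using (⊥-elim)
open import Function using (_∘_; const)
open import Function.Bundles using (mk⇔)
open import Relation.Nullary using (yes; no)
open import Relation.Nullary.Decidable using (_⊎-dec_)
open import Relation.Unary using (Pred; Decidable)
open import Relation.Binary using (Setoid; Symmetric; Rel; _Respects_; _Preserves_⟶_)
open import Relation.Binary.PropositionalEquality
  using (_≡_; _≢_; refl; sym; trans; cong; cong₂; subst; module ≡-Reasoning)
import Algebra.Solver.CommutativeMonoid as CMSolver
open import Data.Nat.Solver using (module +-*-Solver)

private
  variable
    a b p ℓ r : Level
    A : Set a
    k n : ℕ

-- Multisets split into classes

concat-tabulate-empty : (G : Fin k → List A) → (∀ j → G j ≡ []) → concat (tabulate G) ≡ []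
concat-tabulate-empty {k = zero}  G empty = refl
concat-tabulate-empty {k = suc k} G empty =
  cong₂ _++_ (empty fzero) (concat-tabulate-empty (G ∘ fsuc) (empty ∘ fsuc))

concat-tabulate-single : (G : Fin k → List A) (i : Fin k) → (∀ j → j ≢ i → G j ≡ []) →
  concat (tabulate G) ≡ G i
concat-tabulate-single G fzero empty = begin
  G fzero ++ concat (tabulate (G ∘ fsuc))
    ≡⟨ cong (G fzero ++_) (concat-tabulate-empty (G ∘ fsuc) (λ j → empty (fsuc j) λ ())) ⟩
  G fzero ++ []
    ≡⟨ ++-identityʳ (G fzero) ⟩
  G fzero ∎
  where open ≡-Reasoning
concat-tabulate-single G (fsuc i) empty =
  cong₂ _++_ (empty fzero λ ())
             (concat-tabulate-single (G ∘ fsuc) i (λ j j≢i → empty (fsuc j) (j≢i ∘ suc-injective)))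

filter-concat-tabulate : {P : Pred A p} (P? : Decidable P) (F : Fin k → List A) →
  filter P? (concat (tabulate F)) ≡ concat (tabulate (filter P? ∘ F))
filter-concat-tabulate {k = zero}  P? F = refl
filter-concat-tabulate {k = suc k} P? F =
  trans (filter-++ P? (F fzero) _) (cong (filter P? (F fzero) ++_) (filter-concat-tabulate P? (F ∘ fsuc)))

concat-tabulate-insert : ∀ {x : A} (F G : Fin k → List A) (i : Fin k) →
  G i ≡ x ∷ F i → (∀ j → j ≢ i → G j ≡ F j) → concat (tabulate G) ↭.↭ x ∷ concat (tabulate F)
concat-tabulate-insert F G fzero Gi others =
  ↭.↭-reflexive (cong₂ _++_ Gi (cong concat (ListProps.tabulate-cong (λ j → others (fsuc j) λ ()))))
concat-tabulate-insert {x = x} F G (fsuc i) Gi others = ↭.↭-trans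
  (↭.↭-reflexive (cong (_++ concat (tabulate (G ∘ fsuc))) (others fzero λ ())))
  (↭.↭-trans (↭.++⁺ˡ (F fzero) (concat-tabulate-insert (F ∘ fsuc) (G ∘ fsuc) i Gi
                                   (λ j j≢i → others (fsuc j) (j≢i ∘ suc-injective))))
             (↭.shift x (F fzero) _))

Sole : (P : Fin k → Pred A p) → Fin k → Pred A p
Sole P i x = P i x × (∀ j → P j x → j ≡ i)

module _ {P : Fin k → Pred A p} (P? : ∀ i → Decidable (P i)) where

  filter-class : (F : Fin k → List A) → (∀ j → All (Sole P j) (F j)) →
    ∀ i → filter (P? i) (concat (tabulate F)) ≡ F i
  filter-class F pure i = begin
    filter (P? i) (concat (tabulate F))           ≡⟨ filter-concat-tabulate (P? i) F ⟩
    concat (tabulate (λ j → filter (P? i) (F j))) ≡⟨ concat-tabulate-single _ i other-classes ⟩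
    filter (P? i) (F i)                           ≡⟨ filter-all (P? i) (All.map proj₁ (pure i)) ⟩
    F i ∎
    where
    open ≡-Reasoning
    other-classes : ∀ j → j ≢ i → filter (P? i) (F j) ≡ []
    other-classes j j≢i = filter-none (P? i) (All.map (λ (_ , only) Pi → j≢i (sym (only i Pi))) (pure j))

  ↭-classes : ∀ {xs} → All (λ x → ∃ λ i → Sole P i x) xs →
    xs ↭.↭ concat (tabulate (λ i → filter (P? i) xs))
  ↭-classes {[]} [] = ↭.↭-reflexive (sym (concat-tabulate-empty (λ i → filter (P? i) []) (λ _ → refl)))
  ↭-classes {x ∷ xs} ((i , Pix , only) ∷ rest) = ↭.↭-trans (↭.prep x (↭-classes rest))
    (↭.↭-sym (concat-tabulate-insert (λ j → filter (P? j) xs) (λ j → filter (P? j) (x ∷ xs)) i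
      (filter-accept (P? i) Pix)
      (λ j j≢i → filter-reject (P? j) (j≢i ∘ only j))))

classes-determined : (S : Setoid a ℓ) {P : Fin k → Pred (Setoid.Carrier S) p}
  (P? : ∀ i → Decidable (P i)) → (∀ i → P i Respects Setoid._≈_ S) →
  (F G : Fin k → List (Setoid.Carrier S)) →
  (∀ i → All (Sole P i) (F i)) → (∀ i → All (Sole P i) (G i)) →
  PermS._↭_ S (concat (tabulate F)) (concat (tabulate G)) → ∀ i → PermS._↭_ S (F i) (G i)
classes-determined S P? P-resp F G pureF pureG F↭G i = begin
  F i                                 ≡⟨ sym (filter-class P? F pureF i) ⟩
  filter (P? i) (concat (tabulate F)) ↭⟨ PermSP.filter⁺ S (P? i) (P-resp i) F↭G ⟩
  filter (P? i) (concat (tabulate G)) ≡⟨ filter-class P? G pureG i ⟩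
  G i                                 ∎
  where open PermS.PermutationReasoning S

concat-tabulate⁺ : (S : Setoid a ℓ) {F G : Fin k → List (Setoid.Carrier S)} →
  (∀ i → PermS._↭_ S (F i) (G i)) → PermS._↭_ S (concat (tabulate F)) (concat (tabulate G))
concat-tabulate⁺ {k = zero}  S F↭G = PermS.↭-refl S
concat-tabulate⁺ {k = suc k} S F↭G = PermSP.++⁺ S (F↭G fzero) (concat-tabulate⁺ S (F↭G ∘ fsuc))

concatMap⁺ : (S : Setoid a ℓ) (T : Setoid b r) {f : Setoid.Carrier S → List (Setoid.Carrier T)} →
  f Preserves Setoid._≈_ S ⟶ PermS._↭_ T → concatMap f Preserves PermS._↭_ S ⟶ PermS._↭_ T
concatMap⁺ S T f-resp xs↭ys =
  PermSP.foldr-commMonoid (PermS.↭-setoid T) (PermSP.++-isCommutativeMonoid T)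
    (PermSP.map⁺ S (PermS.↭-setoid T) f-resp xs↭ys)

anchor : {R : Rel A ℓ} {P : Pred A p} → Symmetric R → ∀ {xs} → AllPairs R xs →
  (m : Any P xs) → All (λ x → x ≡ Any.lookup m ⊎ R x (Any.lookup m)) xs
anchor R-sym (Rx ∷ Rxs) (here _)  = inj₁ refl ∷ All.map (inj₂ ∘ R-sym) Rx
anchor R-sym (Rx ∷ Rxs) (there m) = inj₂ (All.lookupWith const Rx m) ∷ anchor R-sym Rxs m

-- Splits and partitions

module _ {n : ℕ} where

  ΣΠ-resp : {Π Π′ : PartitionSystem n} → Π ≈Π Π′ → ΣΠ Π ≈Σ ΣΠ Π′
  ΣΠ-resp = concatMap⁺ (PartitionSetoid n) (SplitSetoid n) (↭.↭⇒↭ₛ′ (Setoid.isEquivalence (SplitSetoid n)))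

  ΣΠ-concat-tabulate : (Πs : Fin k → PartitionSystem n) → ΣΠ (concat (tabulate Πs)) ≡ concat (tabulate (ΣΠ ∘ Πs))
  ΣΠ-concat-tabulate {k = zero}  Πs = refl
  ΣΠ-concat-tabulate {k = suc k} Πs =
    trans (concatMap-++ parts (Πs fzero) _) (cong (ΣΠ (Πs fzero) ++_) (ΣΠ-concat-tabulate (Πs ∘ fsuc)))

  All-ΣΠ⁺ : {P : Pred (Subset n) p} {Π : PartitionSystem n} → All (All P ∘ parts) Π → All P (ΣΠ Π)
  All-ΣΠ⁺ = concat⁺ ∘ map⁺

  All-ΣΠ⁻ : {P : Pred (Subset n) p} {Π : PartitionSystem n} → All P (ΣΠ Π) → All (All P ∘ parts) Π
  All-ΣΠ⁻ = map⁻ ∘ concat⁻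

  assemble : {Π : PartitionSystem n} {Πs : Fin k → PartitionSystem n} {S : Fin k → List (Subset n)} →
    Π ≈Π concat (tabulate Πs) → (∀ i → ΣΠ (Πs i) ≈Σ S i) → ΣΠ Π ≈Σ concat (tabulate S)
  assemble {Π = Π} {Πs} {S} Π≈ pieces = begin
    ΣΠ Π                         ↭⟨ ΣΠ-resp Π≈ ⟩
    ΣΠ (concat (tabulate Πs))    ≡⟨ ΣΠ-concat-tabulate Πs ⟩
    concat (tabulate (ΣΠ ∘ Πs))  ↭⟨ concat-tabulate⁺ (SplitSetoid n) pieces ⟩
    concat (tabulate S)          ∎
    where open PermS.PermutationReasoning (SplitSetoid n)

  Proper : Subset n → Set
  Proper A = Nonempty A × Nonempty (∁ A)

  proper-resp : Proper Respects _≈ˢ_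
  proper-resp (inj₁ refl) proper = proper
  proper-resp {y = A} (inj₂ refl) (∁A≢∅ , ∁∁A≢∅) = subst Nonempty (∁∁ A) ∁∁A≢∅ , ∁A≢∅

  disjoint-sym : Symmetric (λ (A C : Subset n) → Empty (A ∩ C))
  disjoint-sym A#C (x , x∈C∩A) = A#C (x , x∈p∩q⁺ (swap (x∈p∩q⁻ _ _ x∈C∩A)))

  ∈-disjoint : {A C : Subset n} {x : Fin n} → Empty (A ∩ C) → x ∈ A → x ∈ ∁ C
  ∈-disjoint A#C x∈A = x∉p⇒x∈∁p (λ x∈C → A#C (_ , x∈p∩q⁺ (x∈A , x∈C)))

  -- Every part of a partition is proper: it misses the points of any other part.
  parts-proper : (π : Partition n) → All Proper (parts π)
  parts-proper π = proper-list (parts π) (atLeast2 π) (nonempty π) (disjoint π)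
    where
    avoiding : ∀ {A x} → x ∈ A → ∀ Cs → All Nonempty Cs → All (λ C → Empty (A ∩ C)) Cs → All Proper Cs
    avoiding x∈A []       []           []           = []
    avoiding x∈A (C ∷ Cs) (C≢∅ ∷ Cs≢∅) (A#C ∷ A#Cs) =
      (C≢∅ , _ , ∈-disjoint A#C x∈A) ∷ avoiding x∈A Cs Cs≢∅ A#Cs
    proper-list : ∀ As → 2 ≤ length As → All Nonempty As → AllPairs (λ A C → Empty (A ∩ C)) As → All Proper As
    proper-list (A ∷ C ∷ Cs) (s≤s (s≤s _)) (A≢∅ ∷ Cs≢∅) (A#Cs ∷ _) =
      (A≢∅ , _ , ∈-disjoint (disjoint-sym (All.head A#Cs)) (proj₂ (All.head Cs≢∅)))
      ∷ avoiding (proj₂ A≢∅) (C ∷ Cs) Cs≢∅ A#Cs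

  ΣΠ-proper : (Π : PartitionSystem n) → All Proper (ΣΠ Π)
  ΣΠ-proper Π = All-ΣΠ⁺ (All.universal parts-proper Π)

  ∈⋃ : ∀ {x} (As : List (Subset n)) → x ∈ ⋃ As → Any (x ∈_) As
  ∈⋃ []       x∈⊥ = ⊥-elim (∉⊥ x∈⊥)
  ∈⋃ (A ∷ As) x∈⋃ = [ here , there ∘ ∈⋃ As ]′ (x∈p∪q⁻ A (⋃ As) x∈⋃)

  part-containing : (π : Partition n) (x : Fin n) → Any (x ∈_) (parts π)
  part-containing π x = ∈⋃ (parts π) (subst (x ∈_) (sym (covers π)) ∈⊤)

-- Splits and partitions below a family of disjoint sets

module BranchSystem {n k : ℕ} (L : Fin k → Subset n) (x₀ : Fin n)
  (x₀∉L : ∀ i → x₀ ∉ L i) (L-disjoint : ∀ {i j x} → x ∈ L i → x ∈ L j → i ≡ j) where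

  private module Σ↭ = PermS (SplitSetoid n)
  private module Π↭ = PermS (PartitionSetoid n)

  Below : Fin k → Subset n → Set
  Below i A = A ⊆ L i ⊎ ∁ A ⊆ L i

  below? : ∀ i → Decidable (Below i)
  below? i A = (A ⊆? L i) ⊎-dec (∁ A ⊆? L i)

  below-resp : ∀ i → Below i Respects _≈ˢ_
  below-resp i (inj₁ refl) below = below
  below-resp i {y = A} (inj₂ refl) (inj₁ ∁A⊆L) = inj₂ ∁A⊆L
  below-resp i {y = A} (inj₂ refl) (inj₂ ∁∁A⊆L) = inj₁ (subst (_⊆ L i) (∁∁ A) ∁∁A⊆L)

  below-∈ : ∀ {i A} → Below i A → x₀ ∈ A → ∁ A ⊆ L i
  below-∈ {i} (inj₁ A⊆L)  x₀∈A = ⊥-elim (x₀∉L i (A⊆L x₀∈A))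
  below-∈     (inj₂ ∁A⊆L) x₀∈A = ∁A⊆L

  below-∉ : ∀ {i A} → Below i A → x₀ ∉ A → A ⊆ L i
  below-∉     (inj₁ A⊆L)  x₀∉A = A⊆L
  below-∉ {i} (inj₂ ∁A⊆L) x₀∉A = ⊥-elim (x₀∉L i (∁A⊆L (x∉p⇒x∈∁p x₀∉A)))

  -- A proper split is below at most one L i: its x₀-free side is non-empty.
  below-unique : ∀ {i j A} → Proper A → Below i A → Below j A → i ≡ j
  below-unique {A = A} (A≢∅ , ∁A≢∅) below-i below-j with x₀ ∈? A
  ... | yes x₀∈A =
    L-disjoint (below-∈ below-i x₀∈A (proj₂ ∁A≢∅)) (below-∈ below-j x₀∈A (proj₂ ∁A≢∅))
  ... | no x₀∉A =
    L-disjoint (below-∉ below-i x₀∉A (proj₂ A≢∅)) (below-∉ below-j x₀∉A (proj₂ A≢∅))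

  below-sole : ∀ {i A} → Proper A → Below i A → Sole Below i A
  below-sole proper below = below , λ j below-j → below-unique proper below-j below

  InBranch : Fin k → Partition n → Set
  InBranch i π = All (Below i) (parts π)

  inBranch? : ∀ i → Decidable (InBranch i)
  inBranch? i π = all? (below? i) (parts π)

  inBranch-resp : ∀ i → InBranch i Respects Setoid._≈_ (PartitionSetoid n)
  inBranch-resp i = ↭.All-resp-↭

  -- A partition lies in at most one branch (its parts are proper).
  inBranch-sole : ∀ {i} (π : Partition n) → InBranch i π → Sole InBranch i π
  inBranch-sole {i} π in-i = in-i , λ j in-j → first-part (parts π) (atLeast2 π) (parts-proper π) in-j in-i
    where
    first-part : ∀ {j} As → 2 ≤ length As → All Proper As → All (Below j) As → All (Below i) As → j ≡ i
    first-part (A ∷ _) _ (proper ∷ _) (below-j ∷ _) (below-i ∷ _) = below-unique proper below-j below-i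

  -- If each part of π is below some L j, then π lies in a branch: the part
  -- A₀ containing x₀ has ∁ A₀ ⊆ L j, and every other part is inside ∁ A₀.
  inBranch-exists : (π : Partition n) → All (λ A → ∃ λ j → Below j A) (parts π) → ∃ λ i → InBranch i π
  inBranch-exists π somewhere with All.lookupAny somewhere (part-containing π x₀)
  ... | (j , below₀) , x₀∈A₀ =
    j , All.map place (anchor disjoint-sym (disjoint π) (part-containing π x₀))
    where
    A₀ : Subset n
    A₀ = Any.lookup (part-containing π x₀)
    place : ∀ {A} → A ≡ A₀ ⊎ Empty (A ∩ A₀) → Below j A
    place (inj₁ refl) = below₀
    place (inj₂ A#A₀) = inj₁ (below-∈ below₀ x₀∈A₀ ∘ ∈-disjoint A#A₀)

  module Decomposition (S : Fin k → List (Subset n)) (S-below : ∀ i → All (Below i) (S i)) where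

    -- Existence: sort the partitions of Π by their branch.
    decompose : (Π : PartitionSystem n) → ΣΠ Π ≈Σ concat (tabulate S) →
      Σ (Fin k → PartitionSystem n) (λ Πs → Π ≈Π concat (tabulate Πs) × (∀ i → ΣΠ (Πs i) ≈Σ S i))
    decompose Π ΣΠ≈S = Πs , Π≈ , pieces
      where
      Πs : Fin k → PartitionSystem n
      Πs i = filter (inBranch? i) Π

      S-proper : ∀ i → All Proper (S i)
      S-proper = tabulate⁻ (concat⁻ (PermSP.All-resp-↭ (SplitSetoid n) proper-resp ΣΠ≈S (ΣΠ-proper Π)))

      ΣΠ-below : All (λ A → ∃ λ j → Below j A) (ΣΠ Π)
      ΣΠ-below = PermSP.All-resp-↭ (SplitSetoid n) (λ eq (j , below) → j , below-resp j eq below)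
        (Σ↭.↭-sym ΣΠ≈S) (concat⁺ (tabulate⁺ (λ i → All.map (i ,_) (S-below i))))

      Π-placed : All (λ π → ∃ λ i → Sole InBranch i π) Π
      Π-placed = All.map (λ {π} → place π ∘ inBranch-exists π) (All-ΣΠ⁻ ΣΠ-below)
        where
        place : ∀ π → ∃ (λ i → InBranch i π) → ∃ λ i → Sole InBranch i π
        place π (i , in-i) = i , inBranch-sole π in-i

      Π≈ : Π ≈Π concat (tabulate Πs)
      Π≈ = ↭.↭⇒↭ₛ′ (Setoid.isEquivalence (PartitionSetoid n)) (↭-classes inBranch? Π-placed)

      Πs-pure : ∀ i → All (Sole Below i) (ΣΠ (Πs i))
      Πs-pure i = All-ΣΠ⁺ (All.map (λ {π} in-i → All.zipWith (uncurry below-sole) (parts-proper π , in-i))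
                                   (all-filter (inBranch? i) Π))

      S-pure : ∀ i → All (Sole Below i) (S i)
      S-pure i = All.zipWith (uncurry below-sole) (S-proper i , S-below i)

      pieces : ∀ i → ΣΠ (Πs i) ≈Σ S i
      pieces = classes-determined (SplitSetoid n) below? below-resp (ΣΠ ∘ Πs) S Πs-pure S-pure (begin
        concat (tabulate (ΣΠ ∘ Πs))  ≡⟨ sym (ΣΠ-concat-tabulate Πs) ⟩
        ΣΠ (concat (tabulate Πs))    ↭⟨ ΣΠ-resp (Π↭.↭-sym Π≈) ⟩
        ΣΠ Π                         ↭⟨ ΣΠ≈S ⟩
        concat (tabulate S)          ∎)
        where open PermS.PermutationReasoning (SplitSetoid n)

    -- Uniqueness: every partition of a piece Π_i lies in branch i.
    decomposition-unique : {Π : PartitionSystem n} (Πs Πs′ : Fin k → PartitionSystem n) →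
      Π ≈Π concat (tabulate Πs) → (∀ i → ΣΠ (Πs i) ≈Σ S i) →
      Π ≈Π concat (tabulate Πs′) → (∀ i → ΣΠ (Πs′ i) ≈Σ S i) →
      ∀ i → Πs i ≈Π Πs′ i
    decomposition-unique Πs Πs′ Π≈ pieces Π≈′ pieces′ =
      classes-determined (PartitionSetoid n) inBranch? inBranch-resp Πs Πs′
        (in-branches Πs pieces) (in-branches Πs′ pieces′) (Π↭.↭-trans (Π↭.↭-sym Π≈) Π≈′)
      where
      in-branches : (Πs : Fin k → PartitionSystem n) → (∀ i → ΣΠ (Πs i) ≈Σ S i) →
        ∀ i → All (Sole InBranch i) (Πs i)
      in-branches Πs pieces i = All.map (λ {π} → inBranch-sole π)
        (All-ΣΠ⁻ (PermSP.All-resp-↭ (SplitSetoid n) (below-resp i) (Σ↭.↭-sym (pieces i)) (S-below i)))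

-- Occurrences and label sets of trees

positive : ℕ → Bool
positive zero    = false
positive (suc _) = true

positive-+ : ∀ m n → positive (m + n) ≡ positive m ∨ positive n
positive-+ zero    n = refl
positive-+ (suc m) n = refl

positive-indicator : ∀ c → positive (if c then 1 else 0) ≡ c
positive-indicator true  = refl
positive-indicator false = refl

positive⇒1≤ : ∀ {m} → positive m ≡ true → 1 ≤ m
positive⇒1≤ {suc m} _ = s≤s z≤n

positive-complement : ∀ {m n} → m + n ≡ 1 → positive m ≡ not (positive n)
positive-complement {zero}        {suc zero} _ = refl
positive-complement {suc zero}    {zero}     _ = refl
positive-complement {zero}        {zero}     ()
positive-complement {zero}        {suc (suc _)} ()
positive-complement {suc zero}    {suc _}    ()
positive-complement {suc (suc _)} {_}        ()

vec-ext : {u w : Vec A n} → (∀ i → Vec.lookup u i ≡ Vec.lookup w i) → u ≡ w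
vec-ext {u = u} {w} same =
  trans (sym (tabulate∘lookup u)) (trans (tabulate-cong same) (tabulate∘lookup w))

mutual
  labels-lookup : (t : Tree n) (x : Fin n) → Vec.lookup (labels t) x ≡ positive (occ x t)
  labels-lookup (node L cs) x = begin
    Vec.lookup (L ∪ labelsF cs) x
      ≡⟨ lookup-zipWith _∨_ x L (labelsF cs) ⟩
    Vec.lookup L x ∨ Vec.lookup (labelsF cs) x
      ≡⟨ cong₂ _∨_ (sym (positive-indicator (Vec.lookup L x))) (labelsF-lookup cs x) ⟩
    positive (if Vec.lookup L x then 1 else 0) ∨ positive (occF x cs)
      ≡⟨ sym (positive-+ _ (occF x cs)) ⟩
    positive (occ x (node L cs)) ∎
    where open ≡-Reasoning

  labelsF-lookup : (cs : List (Tree n)) (x : Fin n) → Vec.lookup (labelsF cs) x ≡ positive (occF x cs)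
  labelsF-lookup []       x = lookup-replicate x false
  labelsF-lookup (c ∷ cs) x =
    trans (lookup-zipWith _∨_ x (labels c) (labelsF cs))
          (trans (cong₂ _∨_ (labels-lookup c x) (labelsF-lookup cs x)) (sym (positive-+ (occ x c) (occF x cs))))

∈labels⇒occurs : ∀ (t : Tree n) {x} → x ∈ labels t → 1 ≤ occ x t
∈labels⇒occurs t {x} x∈t = positive⇒1≤ (trans (sym (labels-lookup t x)) ([]=⇒lookup x∈t))

labels-complement : (t u : Tree n) → (∀ x → occ x t + occ x u ≡ 1) → labels t ≡ ∁ (labels u)
labels-complement t u once = vec-ext λ x → begin
  Vec.lookup (labels t) x        ≡⟨ labels-lookup t x ⟩
  positive (occ x t)             ≡⟨ positive-complement (once x) ⟩
  not (positive (occ x u))       ≡⟨ cong not (sym (labels-lookup u x)) ⟩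
  not (Vec.lookup (labels u) x)  ≡⟨ sym (lookup-map x not (labels u)) ⟩
  Vec.lookup (∁ (labels u)) x    ∎
  where open ≡-Reasoning

All-⊆-widen : {B C : Subset n} {As : List (Subset n)} → B ⊆ C → All (_⊆ B) As → All (_⊆ C) As
All-⊆-widen B⊆C = All.map (λ A⊆B {x} x∈A → B⊆C (A⊆B x∈A))

mutual
  splits-inside : (t : Tree n) → All (_⊆ labels t) (splits t)
  splits-inside (node L cs) = All-⊆-widen (q⊆p∪q L (labelsF cs)) (splitsF-inside cs)

  splitsF-inside : (cs : List (Tree n)) → All (_⊆ labelsF cs) (splitsF cs)
  splitsF-inside []       = []
  splitsF-inside (c ∷ cs) = p⊆p∪q (labelsF cs)
    ∷ ++⁺ (All-⊆-widen (p⊆p∪q (labelsF cs)) (splits-inside c))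
          (All-⊆-widen (q⊆p∪q (labels c) (labelsF cs)) (splitsF-inside cs))

occF-++ : ∀ (x : Fin n) xs ys → occF x (xs ++ ys) ≡ occF x xs + occF x ys
occF-++ x []       ys = refl
occF-++ x (c ∷ xs) ys = trans (cong (occ x c +_) (occF-++ x xs ys)) (sym (+-assoc (occ x c) _ _))

splitsF-++ : (xs ys : List (Tree n)) → splitsF (xs ++ ys) ≡ splitsF xs ++ splitsF ys
splitsF-++ []       ys = refl
splitsF-++ (c ∷ xs) ys = cong (labels c ∷_)
  (trans (cong (splits c ++_) (splitsF-++ xs ys)) (sym (ListProps.++-assoc (splits c) (splitsF xs) (splitsF ys))))

occ≤occF : ∀ (x : Fin n) cs (i : Fin (length cs)) → occ x (List.lookup cs i) ≤ occF x cs
occ≤occF x (c ∷ cs) fzero    = m≤m+n (occ x c) (occF x cs)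
occ≤occF x (c ∷ cs) (fsuc i) = ≤-trans (occ≤occF x cs i) (m≤n+m (occF x cs) (occ x c))

occF-unique : ∀ {x : Fin n} cs {i j : Fin (length cs)} → occF x cs ≤ 1 →
  1 ≤ occ x (List.lookup cs i) → 1 ≤ occ x (List.lookup cs j) → i ≡ j
occF-unique (c ∷ cs) {fzero}  {fzero}  _ _ _ = refl
occF-unique {x = x} (c ∷ cs) {fzero}  {fsuc j} at-most-once in-i in-j =
  ⊥-elim (1+n≰n (≤-trans (+-mono-≤ in-i (≤-trans in-j (occ≤occF x cs j))) at-most-once))
occF-unique {x = x} (c ∷ cs) {fsuc i} {fzero}  at-most-once in-i in-j =
  ⊥-elim (1+n≰n (≤-trans (+-mono-≤ in-j (≤-trans in-i (occ≤occF x cs i))) at-most-once))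
occF-unique {x = x} (c ∷ cs) {fsuc i} {fsuc j} at-most-once in-i in-j =
  cong fsuc (occF-unique cs (≤-trans (m≤n+m (occF x cs) (occ x c)) at-most-once) in-i in-j)

-- Re-rooting a tree at a vertex

plug : Ctx n → Tree n → Tree n
plug top                t = t
plug (down L ls ctx rs) t = plug ctx (node L (ls ++ t ∷ rs))

reroot : Ctx n → Tree n → Tree n
reroot ctx (node L cs) = node L (cs ++ up ctx)

take-lookup-drop : (xs : List A) (i : Fin (length xs)) →
  take (toℕ i) xs ++ List.lookup xs i ∷ drop (suc (toℕ i)) xs ≡ xs
take-lookup-drop (x ∷ xs) fzero    = refl
take-lookup-drop (x ∷ xs) (fsuc i) = cong (x ∷_) (take-lookup-drop xs i)

plug-focusAt : (t : Tree n) (v : Pos t) (ctx : Ctx n) → uncurry plug (focusAt t v ctx) ≡ plug ctx t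
plug-focusAt t           here        ctx = refl
plug-focusAt (node L cs) (there i v) ctx =
  trans (plug-focusAt (List.lookup cs i) v _) (cong (λ cs′ → plug ctx (node L cs′)) (take-lookup-drop cs i))

star : (T : Tree n) → Pos T → Tree n
star T v = node (labelAt T v) (branches T v)

star≡reroot : (T : Tree n) (v : Pos T) → star T v ≡ uncurry reroot (focus T v)
star≡reroot T v with focus T v
... | ctx , node L cs = refl

occ-plug : ∀ (x : Fin n) ctx t → occ x (plug ctx t) ≡ occ x t + occF x (up ctx)
occ-plug x top t = sym (+-identityʳ (occ x t))
occ-plug x (down L ls ctx rs) t = begin
  occ x (plug ctx (node L (ls ++ t ∷ rs)))
    ≡⟨ occ-plug x ctx (node L (ls ++ t ∷ rs)) ⟩
  (mark + occF x (ls ++ t ∷ rs)) + above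
    ≡⟨ cong (λ m → (mark + m) + above) (occF-++ x ls (t ∷ rs)) ⟩
  (mark + (left + (self + right))) + above
    ≡⟨ solve 5 (λ m a o r u → (m :+ (a :+ (o :+ r))) :+ u := o :+ ((m :+ (a :+ (r :+ u))) :+ con 0))
                         refl mark left self right above ⟩
  self + ((mark + (left + (right + above))) + 0)
    ≡⟨ cong (λ m → self + ((mark + m) + 0))
            (sym (trans (occF-++ x ls (rs ++ up ctx)) (cong (left +_) (occF-++ x rs (up ctx))))) ⟩
  occ x t + occF x (up (down L ls ctx rs)) ∎
  where
  open ≡-Reasoning
  open +-*-Solver using (solve; _:+_; _:=_; con)
  mark left self right above : ℕ
  mark = if Vec.lookup L x then 1 else 0
  left = occF x ls
  self = occ x t
  right = occF x rs
  above = occF x (up ctx)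

occ-reroot : ∀ (x : Fin n) ctx t → occ x (reroot ctx t) ≡ occ x (plug ctx t)
occ-reroot x ctx (node L cs) = begin
  mark + occF x (cs ++ up ctx)      ≡⟨ cong (mark +_) (occF-++ x cs (up ctx)) ⟩
  mark + (occF x cs + occF x (up ctx)) ≡⟨ sym (+-assoc mark (occF x cs) _) ⟩
  occ x (node L cs) + occF x (up ctx) ≡⟨ sym (occ-plug x ctx (node L cs)) ⟩
  occ x (plug ctx (node L cs))   ∎
  where
  open ≡-Reasoning
  mark : ℕ
  mark = if Vec.lookup L x then 1 else 0

-- Bookkeeping for the re-rooting step: bring the split σ of the edge to the
-- parent, and the splits below the focused vertex, to the front.
rearrange : (left self right above : List (Subset n)) (σ : Subset n) →
  ((left ++ σ ∷ self ++ right) ++ above) ≈Σ (self ++ σ ∷ (left ++ right ++ above) ++ [])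
rearrange {n} left self right above σ =
  prove 5 ((L ⊕ (E ⊕ (S ⊕ R))) ⊕ U) (S ⊕ (E ⊕ ((L ⊕ (R ⊕ U)) ⊕ id)))
          (left ∷ [ σ ] ∷ self ∷ right ∷ above ∷ [])
  where
  open CMSolver (PermSP.++-commutativeMonoid (SplitSetoid n)) using (prove; var; _⊕_; id; Expr)
  L E S R U : Expr 5
  L = var fzero
  E = var (fsuc fzero)
  S = var (fsuc (fsuc fzero))
  R = var (fsuc (fsuc (fsuc fzero)))
  U = var (fsuc (fsuc (fsuc (fsuc fzero))))

-- In a tree where every element occurs once, re-rooting preserves Σ: the
-- edge to the parent yields complementary splits seen from its two ends.
splits-plug : ∀ ctx (t : Tree n) → (∀ x → occ x (plug ctx t) ≡ 1) →
  splits (plug ctx t) ≈Σ (splits t ++ splitsF (up ctx))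
splits-plug {n} top t _ = PermS.↭-reflexive (SplitSetoid n) (sym (++-identityʳ (splits t)))
splits-plug {n} (down L ls ctx rs) t once = begin
  splits (plug ctx (node L (ls ++ t ∷ rs)))
    ↭⟨ splits-plug ctx (node L (ls ++ t ∷ rs)) once ⟩
  splitsF (ls ++ t ∷ rs) ++ splitsF (up ctx)
    ≡⟨ cong (_++ splitsF (up ctx)) (splitsF-++ ls (t ∷ rs)) ⟩
  (splitsF ls ++ labels t ∷ splits t ++ splitsF rs) ++ splitsF (up ctx)
    ↭⟨ rearrange (splitsF ls) (splits t) (splitsF rs) (splitsF (up ctx)) (labels t) ⟩
  splits t ++ labels t ∷ (splitsF ls ++ splitsF rs ++ splitsF (up ctx)) ++ []
    ↭⟨ PermSP.++⁺ˡ (SplitSetoid n) (splits t) (PermS.prep flipped (PermS.↭-refl (SplitSetoid n))) ⟩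
  splits t ++ labels u ∷ (splitsF ls ++ splitsF rs ++ splitsF (up ctx)) ++ []
    ≡⟨ cong (λ z → splits t ++ labels u ∷ z ++ []) (sym splits-u) ⟩
  splits t ++ splitsF (up (down L ls ctx rs)) ∎
  where
  open PermS.PermutationReasoning (SplitSetoid n)
  u : Tree n
  u = node L (ls ++ rs ++ up ctx)
  splits-u : splits u ≡ splitsF ls ++ splitsF rs ++ splitsF (up ctx)
  splits-u = trans (splitsF-++ ls (rs ++ up ctx)) (cong (splitsF ls ++_) (splitsF-++ rs (up ctx)))
  flipped : labels t ≈ˢ labels u
  flipped = inj₂ (labels-complement t u λ x →
    trans (cong (occ x t +_) (sym (+-identityʳ (occ x u)))) (trans (sym (occ-plug x (down L ls ctx rs) t)) (once x)))

splits-reroot : ∀ ctx (t : Tree n) → (∀ x → occ x (plug ctx t) ≡ 1) →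
  splits (plug ctx t) ≈Σ splits (reroot ctx t)
splits-reroot {n} ctx (node L cs) once =
  PermS.↭-trans (SplitSetoid n) (splits-plug ctx (node L cs) once)
                (PermS.↭-reflexive (SplitSetoid n) (sym (splitsF-++ cs (up ctx))))

-- A weak X-tree seen from a vertex v

occ-star : (T : Tree n) (v : Pos T) (x : Fin n) → occ x (star T v) ≡ occ x T
occ-star T v x = begin
  occ x (star T v)                   ≡⟨ cong (occ x) (star≡reroot T v) ⟩
  occ x (uncurry reroot (focus T v)) ≡⟨ occ-reroot x (proj₁ (focus T v)) (proj₂ (focus T v)) ⟩
  occ x (uncurry plug (focus T v))   ≡⟨ cong (occ x) (plug-focusAt T v top) ⟩
  occ x T                            ∎
  where open ≡-Reasoning

splits-star : (T : Tree n) (v : Pos T) → (∀ x → occ x T ≡ 1) → splits T ≈Σ splits (star T v)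
splits-star {n} T v once = begin
  splits T                            ≡⟨ cong splits (sym (plug-focusAt T v top)) ⟩
  splits (uncurry plug (focus T v))   ↭⟨ splits-reroot (proj₁ (focus T v)) (proj₂ (focus T v)) once-focused ⟩
  splits (uncurry reroot (focus T v)) ≡⟨ cong splits (sym (star≡reroot T v)) ⟩
  splits (star T v)                   ∎
  where
  open PermS.PermutationReasoning (SplitSetoid n)
  once-focused : ∀ x → occ x (uncurry plug (focus T v)) ≡ 1
  once-focused x = trans (cong (occ x) (plug-focusAt T v top)) (once x)

splitsF-tabulate : (cs : List (Tree n)) → splitsF cs ≡ concat (tabulate (λ i → splitsF (List.lookup cs i ∷ [])))
splitsF-tabulate []       = refl
splitsF-tabulate (c ∷ cs) =
  cong (labels c ∷_) (cong₂ _++_ (sym (++-identityʳ (splits c))) (splitsF-tabulate cs))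

splits-decomp : (T : Tree n) (v : Pos T) → (∀ x → occ x T ≡ 1) →
  splits T ≈Σ concat (tabulate (splits ∘ decomp T v))
splits-decomp {n} T v once =
  PermS.↭-trans (SplitSetoid n) (splits-star T v once)
                (PermS.↭-reflexive (SplitSetoid n) (splitsF-tabulate (branches T v)))

branch-labels : (T : Tree n) (v : Pos T) → Fin (degree T v) → Subset n
branch-labels T v i = labels (List.lookup (branches T v) i)

decomp-splits-inside : (T : Tree n) (v : Pos T) (i : Fin (degree T v)) →
  All (_⊆ branch-labels T v i) (splits (decomp T v i))
decomp-splits-inside T v i = ⊆-refl ∷ ++⁺ (splits-inside (List.lookup (branches T v) i)) []

branches-disjoint : (T : Tree n) (v : Pos T) → (∀ x → occ x T ≡ 1) →
  ∀ {i j x} → x ∈ branch-labels T v i → x ∈ branch-labels T v j → i ≡ j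
branches-disjoint T v once {i} {j} {x} x∈i x∈j =
  occF-unique (branches T v) at-most-once
    (∈labels⇒occurs (List.lookup (branches T v) i) x∈i) (∈labels⇒occurs (List.lookup (branches T v) j) x∈j)
  where
  at-most-once : occF x (branches T v) ≤ 1
  at-most-once = subst (occF x (branches T v) ≤_) (trans (occ-star T v x) (once x))
                       (m≤n+m (occF x (branches T v)) _)

label-outside-branches : (T : Tree n) (v : Pos T) → (∀ x → occ x T ≡ 1) →
  ∀ {x i} → x ∈ labelAt T v → x ∉ branch-labels T v i
label-outside-branches {n} T v once {x} {i} x∈v x∈i = 1+n≰n (begin
  1 + 1                           ≤⟨ +-mono-≤ (≤-reflexive (sym v-counts)) (∈labels⇒occurs bᵢ x∈i) ⟩
  mark + occ x bᵢ                 ≤⟨ +-monoʳ-≤ mark (occ≤occF x (branches T v) i) ⟩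
  occ x (star T v)                ≡⟨ trans (occ-star T v x) (once x) ⟩
  1                               ∎)
  where
  open ≤-Reasoning
  bᵢ : Tree n
  bᵢ = List.lookup (branches T v) i
  mark : ℕ
  mark = if Vec.lookup (labelAt T v) x then 1 else 0
  v-counts : mark ≡ 1
  v-counts = cong (λ c → if c then 1 else 0) ([]=⇒lookup x∈v)

lemma6p1 : (n : ℕ) → 2 ≤ n → (T : Tree n) → WeakXTree T →
    (v : Pos T) → Labelled T v → Interior T v → (Π : PartitionSystem n) →
    (Π ∈ℙ T ⇔ Σ (Fin (degree T v) → PartitionSystem n) (λ Πs →
        IsDecompOf Πs Π × ((i : Fin (degree T v)) → Πs i ∈ℙ decomp T v i)))
    × (Π ∈ℙ T → (Πs Πs′ : Fin (degree T v) → PartitionSystem n) →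
        IsDecompOf Πs Π → ((i : Fin (degree T v)) → Πs i ∈ℙ decomp T v i) →
        IsDecompOf Πs′ Π → ((i : Fin (degree T v)) → Πs′ i ∈ℙ decomp T v i) →
        (i : Fin (degree T v)) → Πs i ≈Π Πs′ i)
lemma6p1 n _ T (once , _) v (x₀ , x₀∈v) _ Π =
  mk⇔ (λ Π∈ℙT → decompose Π (Σ↭.↭-trans Π∈ℙT Σ≈⋃Σᵢ))
      (λ (Πs , Π≈ , pieces) → Σ↭.↭-trans (assemble Π≈ pieces) (Σ↭.↭-sym Σ≈⋃Σᵢ))
  , λ _ → decomposition-unique
  where
  module Σ↭ = PermS (SplitSetoid n)
  Σ≈⋃Σᵢ : splits T ≈Σ concat (tabulate (splits ∘ decomp T v))
  Σ≈⋃Σᵢ = splits-decomp T v once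
  open BranchSystem (branch-labels T v) x₀ (λ i → label-outside-branches T v once x₀∈v)
                    (branches-disjoint T v once)
  open Decomposition (splits ∘ decomp T v) (λ i → All.map inj₁ (decomp-splits-inside T v i))
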